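{- Let $a_1,\dots,a_k,b_1,\dots,b_k$ be nonnegative integers such that $a_1+\cdots+a_k=b_1+\cdots+b_k$ and $a_{k-i+1}+\cdots+a_k\le b_{k-i+1}+\cdots+b_k$ for all $i\in\{1,\dots,k\}$. Then there exists a unique $k\times k$ matrix $M=(m_{ij})$ with nonnegative integer entries such that (i) $m_{ij}=0$ whenever $j\le k-i$; (ii) the sum of the entries in column $i$ of $M$ is $b_i$ for every $i\in\{1,\dots,k\}$; (iii) the sum of the entries in row $i$ of $M$ is $a_{k-i+1}$ for every $i\in\{1,\dots,k\}$; (iv) for all $r,r',c,c'\in\{1,\dots,k\}$ with $k+1-c\le r<r'$ and $c<c'$, at least one of $m_{r'c}$ and $m_{rc'}$ equals $0$. -}

module Defs where

open import Data.Nat using (ℕ; zero; suc; _+_; _≤_; _<_)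
open import Data.Fin using (Fin; toℕ; zero; suc)
open import Data.Fin.Base using (opposite)
open import Data.Nat using (_≤ᵇ_)
open import Data.Bool using (if_then_else_)
open import Relation.Binary.PropositionalEquality using (_≡_)
open import Data.Product using (_×_)
open import Data.Sum using (_⊎_)

sumFin : ∀ {n} → (Fin n → ℕ) → ℕ
sumFin {zero}  f = 0
sumFin {suc n} f = f zero + sumFin (λ j → f (suc j))

-- Indices are 0-based: Fin k index j corresponds to paper index j+1.
-- tailSum a i = a_{k-i+1} + ... + a_k  (paper, 1-based), i.e. the sum of a j
-- over 0-based j with k ≤ j + i.
tailSum : ∀ {k} → (Fin k → ℕ) → ℕ → ℕ
tailSum {k} a i = sumFin (λ j → if k ≤ᵇ (toℕ j + i) then a j else 0)

Matrix : ℕ → Set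
Matrix k = Fin k → Fin k → ℕ   -- M r c = m_{r+1, c+1}

IsGoodMatrix : (k : ℕ) → (a b : Fin k → ℕ) → Matrix k → Set
IsGoodMatrix k a b M =
  -- (i) m_ij = 0 whenever j ≤ k - i   (1-based)  ⇔  i'+j'+2 ≤ k (0-based)
  (∀ i j → 2 + toℕ i + toℕ j ≤ k → M i j ≡ 0)
  × (∀ c → sumFin (λ r → M r c) ≡ b c)
  × (∀ r → sumFin (λ c → M r c) ≡ a (opposite r))
  × (∀ r r' c c' → k ≤ toℕ r + toℕ c + 1 → toℕ r < toℕ r' → toℕ c < toℕ c' →
       (M r' c ≡ 0) ⊎ (M r c' ≡ 0))

-- In 0-based indices cell (r, c) is allowed to be nonzero iff k ≤ r + c + 1.
-- For such a cell, condition (iv) says: if anything is placed below (r, c) in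
-- column c then nothing is placed right of it in row r.  With the row and
-- column sums this pins the entry down as the minimum of what its row and its
-- column still lack, so any two solutions agree, cell by cell in the
-- column-major order.  Conversely, filling the columns from left to right, each
-- from top to bottom, greedily with min(remaining row capacity, remaining
-- demand) satisfies (iv), and the dominance hypothesis on tail sums says that
-- the rows allowed in the first c + 1 columns can carry the demand of those
-- columns, which is exactly what lets every column be completed.
module Submission where

open import Defs
open import Data.Bool using (true; false; if_then_else_)
open import Data.Empty using (⊥-elim)
open import Data.Fin using (Fin; toℕ; fromℕ<; opposite)
import Data.Fin as Fin
open import Data.Fin.Properties using (toℕ<n; toℕ-fromℕ<; fromℕ<-toℕ; opposite-prop)
open import Data.Nat
open import Data.Nat.Induction using (<-rec)
open import Data.Nat.Properties
open import Algebra.Properties.CommutativeSemigroup +-commutativeSemigroup using (interchange)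
open import Data.Product using (Σ-syntax; _×_; _,_; proj₁; proj₂)
open import Data.Sum using (_⊎_; inj₁; inj₂)
open import Relation.Binary.PropositionalEquality
open import Relation.Nullary using (¬_; yes; no; ¬?)
open import Relation.Nullary.Decidable using (_×-dec_; decidable-stable)

if-≤ᵇ-true : ∀ {m n} (x : ℕ) → m ≤ n → (if m ≤ᵇ n then x else 0) ≡ x
if-≤ᵇ-true {m} {n} x m≤n with m ≤ᵇ n | ≤⇒≤ᵇ m≤n
... | true | _ = refl

if-≤ᵇ-false : ∀ {m n} (x : ℕ) → ¬ m ≤ n → (if m ≤ᵇ n then x else 0) ≡ 0
if-≤ᵇ-false {m} {n} x m≰n with m ≤ᵇ n | ≤ᵇ⇒≤ m n
... | false | _      = refl
... | true  | sound = ⊥-elim (m≰n (sound _))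

sumTo : ℕ → (ℕ → ℕ) → ℕ
sumTo zero    f = 0
sumTo (suc n) f = sumTo n f + f n

sumTo-cong : ∀ n {f g : ℕ → ℕ} → (∀ i → i < n → f i ≡ g i) → sumTo n f ≡ sumTo n g
sumTo-cong zero    f≡g = refl
sumTo-cong (suc n) f≡g = cong₂ _+_ (sumTo-cong n (λ i i<n → f≡g i (m<n⇒m<1+n i<n))) (f≡g n ≤-refl)

sumTo-zero : ∀ n {f : ℕ → ℕ} → (∀ i → i < n → f i ≡ 0) → sumTo n f ≡ 0
sumTo-zero zero    f≡0 = refl
sumTo-zero (suc n) f≡0 = cong₂ _+_ (sumTo-zero n (λ i i<n → f≡0 i (m<n⇒m<1+n i<n))) (f≡0 n ≤-refl)

sumTo-monoʳ-≤ : ∀ n {f g : ℕ → ℕ} → (∀ i → i < n → f i ≤ g i) → sumTo n f ≤ sumTo n g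
sumTo-monoʳ-≤ zero    f≤g = z≤n
sumTo-monoʳ-≤ (suc n) f≤g = +-mono-≤ (sumTo-monoʳ-≤ n (λ i i<n → f≤g i (m<n⇒m<1+n i<n))) (f≤g n ≤-refl)

sumTo-+ : ∀ n (f g : ℕ → ℕ) → sumTo n (λ i → f i + g i) ≡ sumTo n f + sumTo n g
sumTo-+ zero    f g = refl
sumTo-+ (suc n) f g =
  trans (cong (_+ (f n + g n)) (sumTo-+ n f g)) (interchange (sumTo n f) (sumTo n g) (f n) (g n))

sumTo-split : ∀ m n (f : ℕ → ℕ) → sumTo (m + n) f ≡ sumTo m f + sumTo n (λ j → f (m + j))
sumTo-split m zero    f = trans (cong (λ l → sumTo l f) (+-identityʳ m)) (sym (+-identityʳ _))
sumTo-split m (suc n) f = begin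
  sumTo (m + suc n) f                                ≡⟨ cong (λ l → sumTo l f) (+-suc m n) ⟩
  sumTo (m + n) f + f (m + n)                        ≡⟨ cong (_+ f (m + n)) (sumTo-split m n f) ⟩
  sumTo m f + sumTo n (λ j → f (m + j)) + f (m + n)  ≡⟨ +-assoc (sumTo m f) _ _ ⟩
  sumTo m f + sumTo (suc n) (λ j → f (m + j))        ∎
  where open ≡-Reasoning

sumTo-monoˡ-≤ : ∀ {m n} (f : ℕ → ℕ) → m ≤ n → sumTo m f ≤ sumTo n f
sumTo-monoˡ-≤ {m} {n} f m≤n = begin
  sumTo m f                                    ≤⟨ m≤m+n _ _ ⟩
  sumTo m f + sumTo (n ∸ m) (λ j → f (m + j))  ≡⟨ sumTo-split m (n ∸ m) f ⟨
  sumTo (m + (n ∸ m)) f                        ≡⟨ cong (λ l → sumTo l f) (m+[n∸m]≡n m≤n) ⟩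
  sumTo n f                                    ∎
  where open ≤-Reasoning

sumTo-front : ∀ n (f : ℕ → ℕ) → sumTo (suc n) f ≡ f 0 + sumTo n (λ i → f (suc i))
sumTo-front zero    f = sym (+-identityʳ (f 0))
sumTo-front (suc n) f = trans (cong (_+ f (suc n)) (sumTo-front n f)) (+-assoc (f 0) _ _)

sumTo-reverse : ∀ n (f : ℕ → ℕ) → sumTo n (λ i → f (n ∸ suc i)) ≡ sumTo n f
sumTo-reverse zero    f = refl
sumTo-reverse (suc n) f = begin
  sumTo (suc n) (λ i → f (suc n ∸ suc i))  ≡⟨ sumTo-front n _ ⟩
  f n + sumTo n (λ i → f (n ∸ suc i))      ≡⟨ cong (f n +_) (sumTo-reverse n f) ⟩
  f n + sumTo n f                          ≡⟨ +-comm (f n) _ ⟩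
  sumTo (suc n) f                          ∎
  where open ≡-Reasoning

≤-+-≡⇒≡ : ∀ {a b c d} → a ≤ b → c ≤ d → a + c ≡ b + d → a ≡ b × c ≡ d
≤-+-≡⇒≡ {a} {b} {c} {d} a≤b c≤d sums≡ = a≡b , +-cancelˡ-≡ a c d (trans sums≡ (cong (_+ d) (sym a≡b)))
  where
  a≡b = ≤-antisym a≤b (+-cancelʳ-≤ c b a (≤-trans (+-monoʳ-≤ b c≤d) (≤-reflexive (sym sums≡))))

sumTo-≤-≡⇒≡ : ∀ n {f g : ℕ → ℕ} → (∀ i → i < n → f i ≤ g i) →
              sumTo n f ≡ sumTo n g → ∀ i → i < n → f i ≡ g i
sumTo-≤-≡⇒≡ (suc n) {f} {g} f≤g sums≡ = pointwise
  where
  f≤g′ : ∀ i → i < n → f i ≤ g i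
  f≤g′ i i<n = f≤g i (m<n⇒m<1+n i<n)
  split = ≤-+-≡⇒≡ (sumTo-monoʳ-≤ n f≤g′) (f≤g n ≤-refl) sums≡
  pointwise : ∀ i → i < suc n → f i ≡ g i
  pointwise i i<1+n with m<1+n⇒m<n∨m≡n i<1+n
  ... | inj₁ i<n  = sumTo-≤-≡⇒≡ n f≤g′ (proj₁ split) i i<n
  ... | inj₂ refl = proj₂ split

sumTo-tail-zero : ∀ {m n} (f : ℕ → ℕ) → m ≤ n → (∀ j → m ≤ j → j < n → f j ≡ 0) →
                  sumTo n f ≡ sumTo m f
sumTo-tail-zero {m} {n} f m≤n tail≡0 = begin
  sumTo n f                                    ≡⟨ cong (λ l → sumTo l f) (m+[n∸m]≡n m≤n) ⟨
  sumTo (m + (n ∸ m)) f                        ≡⟨ sumTo-split m (n ∸ m) f ⟩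
  sumTo m f + sumTo (n ∸ m) (λ j → f (m + j))  ≡⟨ cong (sumTo m f +_) (sumTo-zero (n ∸ m) tail′≡0) ⟩
  sumTo m f + 0                                ≡⟨ +-identityʳ _ ⟩
  sumTo m f                                    ∎
  where
  open ≡-Reasoning
  tail′≡0 : ∀ j → j < n ∸ m → f (m + j) ≡ 0
  tail′≡0 j j<n∸m = tail≡0 (m + j) (m≤m+n m j)
    (subst (m + j <_) (m+[n∸m]≡n m≤n) (+-monoʳ-< m j<n∸m))

entry-≤-residual : ∀ n (f : ℕ → ℕ) {i} → i < n → f i ≤ sumTo n f ∸ sumTo i f
entry-≤-residual n f {i} i<n =
  m+n≤o⇒m≤o∸n (f i) (subst (_≤ sumTo n f) (+-comm (sumTo i f) (f i)) (sumTo-monoˡ-≤ f i<n))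

entry-≡-residual : ∀ n (f : ℕ → ℕ) {i} → i < n → (∀ j → i < j → j < n → f j ≡ 0) →
                   f i ≡ sumTo n f ∸ sumTo i f
entry-≡-residual n f {i} i<n tail≡0 =
  sym (trans (cong (_∸ sumTo i f) (sumTo-tail-zero f i<n tail≡0)) (m+n∸m≡n (sumTo i f) (f i)))

suffixSum : ℕ → (ℕ → ℕ) → ℕ → ℕ
suffixSum n x i = sumTo i (λ t → x (n ∸ i + t))

sumTo-prefix-suffix : ∀ {n i} (x : ℕ → ℕ) → i ≤ n → sumTo n x ≡ sumTo (n ∸ i) x + suffixSum n x i
sumTo-prefix-suffix {n} {i} x i≤n =
  trans (cong (λ l → sumTo l x) (sym (m∸n+n≡m i≤n))) (sumTo-split (n ∸ i) i x)

masked-sum≡suffixSum : ∀ {n i} (x : ℕ → ℕ) → i ≤ n →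
  sumTo n (λ j → if n ≤ᵇ j + i then x j else 0) ≡ suffixSum n x i
masked-sum≡suffixSum {n} {i} x i≤n = begin
  sumTo n masked                                      ≡⟨ sumTo-prefix-suffix masked i≤n ⟩
  sumTo (n ∸ i) masked + suffixSum n masked i         ≡⟨ cong₂ _+_ (sumTo-zero (n ∸ i) prefix≡0) suffix≡ ⟩
  suffixSum n x i                                     ∎
  where
  open ≡-Reasoning
  masked : ℕ → ℕ
  masked j = if n ≤ᵇ j + i then x j else 0
  prefix≡0 : ∀ j → j < n ∸ i → masked j ≡ 0
  prefix≡0 j j<n∸i = if-≤ᵇ-false (x j) (<⇒≱ (subst (j + i <_) (m∸n+n≡m i≤n) (+-monoˡ-< i j<n∸i)))
  suffix≡ : suffixSum n masked i ≡ suffixSum n x i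
  suffix≡ = sumTo-cong i (λ t _ → if-≤ᵇ-true (x (n ∸ i + t))
    (subst (_≤ n ∸ i + t + i) (m∸n+n≡m i≤n) (+-monoˡ-≤ i (m≤m+n (n ∸ i) t))))

suffixSum-reverse : ∀ {m n} (x : ℕ → ℕ) → m ≤ n → suffixSum n (λ r → x (n ∸ suc r)) m ≡ sumTo m x
suffixSum-reverse {m} {n} x m≤n = trans (sumTo-cong m (λ t _ → cong x (index≡ t))) (sumTo-reverse m x)
  where
  index≡ : ∀ t → n ∸ suc (n ∸ m + t) ≡ m ∸ suc t
  index≡ t = begin
    n ∸ suc (n ∸ m + t)  ≡⟨ cong (n ∸_) (+-suc (n ∸ m) t) ⟨
    n ∸ (n ∸ m + suc t)  ≡⟨ ∸-+-assoc n (n ∸ m) (suc t) ⟨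
    n ∸ (n ∸ m) ∸ suc t  ≡⟨ cong (_∸ suc t) (m∸[m∸n]≡n m≤n) ⟩
    m ∸ suc t            ∎
    where open ≡-Reasoning

prefix-≤ : ∀ {n i} (x y : ℕ → ℕ) → i ≤ n → sumTo n x ≡ sumTo n y →
           suffixSum n y i ≤ suffixSum n x i → sumTo (n ∸ i) x ≤ sumTo (n ∸ i) y
prefix-≤ {n} {i} x y i≤n totals≡ suffix≤ = +-cancelʳ-≤ (suffixSum n x i) _ _ (begin
  sumTo (n ∸ i) x + suffixSum n x i  ≡⟨ sumTo-prefix-suffix x i≤n ⟨
  sumTo n x                          ≡⟨ totals≡ ⟩
  sumTo n y                          ≡⟨ sumTo-prefix-suffix y i≤n ⟩
  sumTo (n ∸ i) y + suffixSum n y i  ≤⟨ +-monoʳ-≤ _ suffix≤ ⟩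
  sumTo (n ∸ i) y + suffixSum n x i  ∎)
  where open ≤-Reasoning

-- Demand d poured greedily into bins of capacities room 0, room 1, …:
-- the first n bins then hold exactly d ⊓ sumTo n room.
greedy : (ℕ → ℕ) → ℕ → ℕ → ℕ
greedy room d r = d ⊓ sumTo (suc r) room ∸ d ⊓ sumTo r room

greedy-sum : ∀ (room : ℕ → ℕ) d n → sumTo n (greedy room d) ≡ d ⊓ sumTo n room
greedy-sum room d zero    = sym (⊓-zeroʳ d)
greedy-sum room d (suc n) =
  trans (cong (_+ greedy room d n) (greedy-sum room d n))
        (m+[n∸m]≡n (⊓-monoʳ-≤ d (m≤m+n (sumTo n room) (room n))))

greedy-≤ : ∀ (room : ℕ → ℕ) d r → greedy room d r ≤ room r
greedy-≤ room d r = m≤n+o⇒m∸n≤o _ (d ⊓ s) (begin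
  d ⊓ (s + room r)            ≤⟨ ⊓-monoˡ-≤ (s + room r) (m≤m+n d (room r)) ⟩
  (d + room r) ⊓ (s + room r) ≡⟨ +-distribʳ-⊓ (room r) d s ⟨
  d ⊓ s + room r              ∎)
  where
  open ≤-Reasoning
  s = sumTo r room

greedy-≡0 : ∀ (room : ℕ → ℕ) {d} r → d ≤ sumTo r room → greedy room d r ≡ 0
greedy-≡0 room {d} r d≤s = trans
  (cong₂ _∸_ (m≤n⇒m⊓n≡m (≤-trans d≤s (m≤m+n _ (room r)))) (m≤n⇒m⊓n≡m d≤s)) (n∸n≡0 d)

greedy-≡room : ∀ (room : ℕ → ℕ) {d} r → sumTo (suc r) room ≤ d → greedy room d r ≡ room r
greedy-≡room room {d} r s≤d = trans
  (cong₂ _∸_ (m≥n⇒m⊓n≡n s≤d) (m≥n⇒m⊓n≡n (≤-trans (m≤m+n _ (room r)) s≤d)))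
  (m+n∸m≡n (sumTo r room) (room r))

greedy-saturated : ∀ (room : ℕ → ℕ) {d r r'} → r < r' → greedy room d r' ≢ 0 → greedy room d r ≡ room r
greedy-saturated room {d} {r} {r'} r<r' nonzero with d ≤? sumTo r' room
... | yes d≤s = ⊥-elim (nonzero (greedy-≡0 room r' d≤s))
... | no  d≰s = greedy-≡room room r (≤-trans (sumTo-monoˡ-≤ room r<r') (<⇒≤ (≰⇒> d≰s)))

module Staircase (k : ℕ) (row col : ℕ → ℕ) where

  Eligible : ℕ → ℕ → Set
  Eligible r c = k ≤ r + suc c

  record Good (N : ℕ → ℕ → ℕ) : Set where
    field
      ineligible-zero : ∀ r c → r < k → c < k → ¬ Eligible r c → N r c ≡ 0
      column-sum      : ∀ c → c < k → sumTo k (λ r → N r c) ≡ col c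
      row-sum         : ∀ r → r < k → sumTo k (N r) ≡ row r
      exclusion       : ∀ r r' c c' → r' < k → c' < k → Eligible r c → r < r' → c < c' →
                        N r' c ≡ 0 ⊎ N r c' ≡ 0

  good-entry : ∀ {N} → Good N → ∀ {r c} → r < k → c < k → Eligible r c →
    N r c ≡ (row r ∸ sumTo c (N r)) ⊓ (col c ∸ sumTo r (λ r' → N r' c))
  good-entry {N} good {r} {c} r<k c<k eligible = entry≡min
    where
    open Good good
    rowResidual columnResidual : ℕ
    rowResidual    = row r ∸ sumTo c (N r)
    columnResidual = col c ∸ sumTo r (λ r' → N r' c)

    ≤rowResidual : N r c ≤ rowResidual
    ≤rowResidual = subst (λ s → N r c ≤ s ∸ sumTo c (N r)) (row-sum r r<k) (entry-≤-residual k (N r) c<k)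

    ≤columnResidual : N r c ≤ columnResidual
    ≤columnResidual = subst (λ s → N r c ≤ s ∸ sumTo r (λ r' → N r' c)) (column-sum c c<k)
      (entry-≤-residual k (λ r' → N r' c) r<k)

    entry≡min : N r c ≡ rowResidual ⊓ columnResidual
    entry≡min with anyUpTo? (λ r' → r <? r' ×-dec ¬? (N r' c ≟ 0)) k
    ... | yes (r' , r'<k , r<r' , nonzero) =
          trans atRow (sym (m≤n⇒m⊓n≡m (subst (_≤ columnResidual) atRow ≤columnResidual)))
      where
      rowTail≡0 : ∀ c' → c < c' → c' < k → N r c' ≡ 0
      rowTail≡0 c' c<c' c'<k with exclusion r r' c c' r'<k c'<k eligible r<r' c<c'
      ... | inj₁ below≡0 = ⊥-elim (nonzero below≡0)
      ... | inj₂ right≡0 = right≡0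
      atRow : N r c ≡ rowResidual
      atRow = trans (entry-≡-residual k (N r) c<k rowTail≡0) (cong (_∸ sumTo c (N r)) (row-sum r r<k))
    ... | no noneBelow =
          trans atColumn (sym (m≥n⇒m⊓n≡n (subst (_≤ rowResidual) atColumn ≤rowResidual)))
      where
      columnTail≡0 : ∀ r' → r < r' → r' < k → N r' c ≡ 0
      columnTail≡0 r' r<r' r'<k =
        decidable-stable (N r' c ≟ 0) (λ nonzero → noneBelow (r' , r'<k , r<r' , nonzero))
      atColumn : N r c ≡ columnResidual
      atColumn = trans (entry-≡-residual k (λ r' → N r' c) r<k columnTail≡0)
        (cong (_∸ sumTo r (λ r' → N r' c)) (column-sum c c<k))

  good-unique : ∀ {N N'} → Good N → Good N' → ∀ c r → c < k → r < k → N r c ≡ N' r c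
  good-unique {N} {N'} good good' =
    <-rec (λ c → ∀ r → c < k → r < k → N r c ≡ N' r c) λ c left →
    <-rec (λ r → c < k → r < k → N r c ≡ N' r c) λ r above c<k r<k →
      agree r<k c<k (λ c'<c → left c'<c r (<-trans c'<c c<k) r<k)
                    (λ r'<r → above r'<r c<k (<-trans r'<r r<k))
    where
    agree : ∀ {r c} → r < k → c < k → (∀ {c'} → c' < c → N r c' ≡ N' r c') →
            (∀ {r'} → r' < r → N r' c ≡ N' r' c) → N r c ≡ N' r c
    agree {r} {c} r<k c<k left above with k ≤? r + suc c
    ... | no ineligible = trans (Good.ineligible-zero good r c r<k c<k ineligible)
                            (sym (Good.ineligible-zero good' r c r<k c<k ineligible))
    ... | yes eligible = begin
      N r c                                                               ≡⟨ good-entry good r<k c<k eligible ⟩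
      (row r ∸ sumTo c (N r)) ⊓ (col c ∸ sumTo r (λ r' → N r' c))         ≡⟨ cong₂ (λ u v → (row r ∸ u) ⊓ (col c ∸ v))
                                                                               (sumTo-cong c (λ _ c'<c → left c'<c))
                                                                               (sumTo-cong r (λ _ r'<r → above r'<r)) ⟩
      (row r ∸ sumTo c (N' r)) ⊓ (col c ∸ sumTo r (λ r' → N' r' c))      ≡⟨ good-entry good' r<k c<k eligible ⟨
      N' r c                                                              ∎
      where open ≡-Reasoning

  mutual
    used : ℕ → ℕ → ℕ
    used zero    r = 0
    used (suc c) r = used c r + greedyMatrix r c

    greedyMatrix : ℕ → ℕ → ℕ
    greedyMatrix r c = greedy (room c) (col c) r

    room : ℕ → ℕ → ℕ
    room c r = if k ≤ᵇ r + suc c then row r ∸ used c r else 0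

  used≡sumTo : ∀ c r → used c r ≡ sumTo c (greedyMatrix r)
  used≡sumTo zero    r = refl
  used≡sumTo (suc c) r = cong (_+ greedyMatrix r c) (used≡sumTo c r)

  room-≤ : ∀ c r → room c r ≤ row r ∸ used c r
  room-≤ c r with k ≤ᵇ r + suc c
  ... | true  = ≤-refl
  ... | false = z≤n

  greedyMatrix-≤ : ∀ r c → greedyMatrix r c ≤ row r ∸ used c r
  greedyMatrix-≤ r c = ≤-trans (greedy-≤ (room c) (col c) r) (room-≤ c r)

  used-≤-row : ∀ c r → used c r ≤ row r
  used-≤-row zero    r = z≤n
  used-≤-row (suc c) r =
    ≤-trans (+-monoʳ-≤ (used c r) (greedyMatrix-≤ r c)) (≤-reflexive (m+[n∸m]≡n (used-≤-row c r)))

  used-monoˡ-≤ : ∀ {c c'} r → c ≤ c' → used c r ≤ used c' r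
  used-monoˡ-≤ {c} {c'} r c≤c' = subst₂ _≤_ (sym (used≡sumTo c r)) (sym (used≡sumTo c' r))
    (sumTo-monoˡ-≤ (greedyMatrix r) c≤c')

  module _ (fits : ∀ c → c < k → sumTo (suc c) col ≤ sumTo k (λ r → if k ≤ᵇ r + suc c then row r else 0))
           (balanced : sumTo k col ≡ sumTo k row) where

    eligible-row-≤ : ∀ c r → (if k ≤ᵇ r + suc c then row r else 0) ≤
                             (if k ≤ᵇ r + suc c then row r ∸ used c r else 0) + used c r
    eligible-row-≤ c r with k ≤ᵇ r + suc c
    ... | true  = ≤-reflexive (sym (m∸n+n≡m (used-≤-row c r)))
    ... | false = z≤n

    -- The rows eligible for column c hold at least the demand of columns 0 … c,
    -- and columns 0 … c - 1 used only sumTo c col of them.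
    column-fits : ∀ c → c < k → sumTo k (used c) ≡ sumTo c col → col c ≤ sumTo k (room c)
    column-fits c c<k usedTotal = +-cancelˡ-≤ (sumTo c col) _ _ (begin
      sumTo c col + col c                                       ≤⟨ fits c c<k ⟩
      sumTo k (λ r → if k ≤ᵇ r + suc c then row r else 0)       ≤⟨ sumTo-monoʳ-≤ k (λ r _ → eligible-row-≤ c r) ⟩
      sumTo k (λ r → room c r + used c r)                       ≡⟨ sumTo-+ k (room c) (used c) ⟩
      sumTo k (room c) + sumTo k (used c)                       ≡⟨ cong (sumTo k (room c) +_) usedTotal ⟩
      sumTo k (room c) + sumTo c col                            ≡⟨ +-comm (sumTo k (room c)) _ ⟩
      sumTo c col + sumTo k (room c)                            ∎)
      where open ≤-Reasoning

    column-full : ∀ c → c < k → sumTo k (used c) ≡ sumTo c col → sumTo k (λ r → greedyMatrix r c) ≡ col c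
    column-full c c<k usedTotal =
      trans (greedy-sum (room c) (col c) k) (m≤n⇒m⊓n≡m (column-fits c c<k usedTotal))

    used-total : ∀ c → c ≤ k → sumTo k (used c) ≡ sumTo c col
    used-total zero    _   = sumTo-zero k (λ _ _ → refl)
    used-total (suc c) c<k = trans (sumTo-+ k (used c) (λ r → greedyMatrix r c))
      (cong₂ _+_ usedTotal (column-full c c<k usedTotal))
      where usedTotal = used-total c (<⇒≤ c<k)

    row-exhausted : ∀ {r c} → Eligible r c → greedyMatrix r c ≡ room c r → used (suc c) r ≡ row r
    row-exhausted {r} {c} eligible saturated = trans
      (cong (used c r +_) (trans saturated (if-≤ᵇ-true (row r ∸ used c r) eligible)))
      (m+[n∸m]≡n (used-≤-row c r))

    greedy-good : Good greedyMatrix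
    greedy-good = record
      { ineligible-zero = λ r c _ _ ineligible → n≤0⇒n≡0
          (≤-trans (greedy-≤ (room c) (col c) r) (≤-reflexive (if-≤ᵇ-false (row r ∸ used c r) ineligible)))
      ; column-sum = λ c c<k → column-full c c<k (used-total c (<⇒≤ c<k))
      ; row-sum = λ r r<k → trans (sym (used≡sumTo k r))
          (sumTo-≤-≡⇒≡ k (λ r _ → used-≤-row k r) (trans (used-total k ≤-refl) balanced) r r<k)
      ; exclusion = exclusion
      }
      where
      exclusion : ∀ r r' c c' → r' < k → c' < k → Eligible r c → r < r' → c < c' →
                  greedyMatrix r' c ≡ 0 ⊎ greedyMatrix r c' ≡ 0
      exclusion r r' c c' _ _ eligible r<r' c<c' with greedyMatrix r' c ≟ 0
      ... | yes below≡0 = inj₁ below≡0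
      ... | no  nonzero = inj₂ (n≤0⇒n≡0 (begin
        greedyMatrix r c'         ≤⟨ greedyMatrix-≤ r c' ⟩
        row r ∸ used c' r         ≤⟨ ∸-monoʳ-≤ (row r) (used-monoˡ-≤ r c<c') ⟩
        row r ∸ used (suc c) r    ≡⟨ cong (row r ∸_) exhausted ⟩
        row r ∸ row r             ≡⟨ n∸n≡0 (row r) ⟩
        0                         ∎))
        where
        open ≤-Reasoning
        exhausted : used (suc c) r ≡ row r
        exhausted = row-exhausted {r} {c} eligible (greedy-saturated (room c) {col c} r<r' nonzero)

extend : ∀ {k} → (Fin k → ℕ) → ℕ → ℕ
extend {k} f i with i <? k
... | yes i<k = f (fromℕ< i<k)
... | no  _   = 0

extend-toℕ : ∀ {k} (f : Fin k → ℕ) (j : Fin k) → extend f (toℕ j) ≡ f j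
extend-toℕ {k} f j with toℕ j <? k
... | yes j<k = cong f (fromℕ<-toℕ j j<k)
... | no  j≮k = ⊥-elim (j≮k (toℕ<n j))

extendMatrix : ∀ {k} → Matrix k → ℕ → ℕ → ℕ
extendMatrix M i j = extend (λ i' → extend (M i') j) i

extendMatrix-toℕ : ∀ {k} (M : Matrix k) i j → extendMatrix M (toℕ i) (toℕ j) ≡ M i j
extendMatrix-toℕ M i j = trans (extend-toℕ _ i) (extend-toℕ (M i) j)

sumFin≡sumTo : ∀ n {g : Fin n → ℕ} {f : ℕ → ℕ} → (∀ j → g j ≡ f (toℕ j)) → sumFin g ≡ sumTo n f
sumFin≡sumTo zero    g≡f = refl
sumFin≡sumTo (suc n) g≡f =
  trans (cong₂ _+_ (g≡f Fin.zero) (sumFin≡sumTo n (λ j → g≡f (Fin.suc j)))) (sym (sumTo-front n _))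

sumFin≡sumTo-extend : ∀ {n} (g : Fin n → ℕ) → sumFin g ≡ sumTo n (extend g)
sumFin≡sumTo-extend {n} g = sumFin≡sumTo n (λ j → sym (extend-toℕ g j))

data InRange (k : ℕ) : ℕ → Set where
  fin : (j : Fin k) → InRange k (toℕ j)

inRange : ∀ {k i} → i < k → InRange k i
inRange i<k = subst (InRange _) (toℕ-fromℕ< i<k) (fin (fromℕ< i<k))

-- Row r of the paper carries a_{k-r+1}, so the 0-based row r carries a (k - 1 - r).
module FinStaircase {k : ℕ} (a b : Fin k → ℕ) where

  row : ℕ → ℕ
  row r = extend a (k ∸ suc r)

  open Staircase k row (extend b) public

  row-opposite : ∀ r → row (toℕ r) ≡ a (opposite r)
  row-opposite r = trans (cong (extend a) (sym (opposite-prop r))) (extend-toℕ a (opposite r))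

  restrict-good : ∀ {N} → Good N → IsGoodMatrix k a b (λ i j → N (toℕ i) (toℕ j))
  restrict-good {N} good =
      (λ i j 2+i+j≤k → ineligible-zero (toℕ i) (toℕ j) (toℕ<n i) (toℕ<n j)
                         (<⇒≱ (subst (_< k) (sym (+-suc (toℕ i) (toℕ j))) 2+i+j≤k)))
    , (λ c → trans (sumFin≡sumTo k (λ _ → refl)) (trans (column-sum (toℕ c) (toℕ<n c)) (extend-toℕ b c)))
    , (λ r → trans (sumFin≡sumTo k (λ _ → refl)) (trans (row-sum (toℕ r) (toℕ<n r)) (row-opposite r)))
    , (λ r r' c c' eligible → exclusion (toℕ r) (toℕ r') (toℕ c) (toℕ c') (toℕ<n r') (toℕ<n c')
                                (subst (k ≤_) (r+c+1≡r+suc-c (toℕ r) (toℕ c)) eligible))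
    where
    open Good good
    r+c+1≡r+suc-c : ∀ r c → r + c + 1 ≡ r + suc c
    r+c+1≡r+suc-c r c = trans (+-assoc r c 1) (cong (r +_) (+-comm c 1))

  extend-good : ∀ {M} → IsGoodMatrix k a b M → Good (extendMatrix M)
  extend-good {M} (ineligible≡0 , column≡ , row≡ , exclusive) = record
    { ineligible-zero = ineligible-zero
    ; column-sum = column-sum
    ; row-sum = row-sum
    ; exclusion = exclusion
    }
    where
    N = extendMatrix M

    ineligible-zero : ∀ r c → r < k → c < k → ¬ Eligible r c → N r c ≡ 0
    ineligible-zero r c r<k c<k ineligible with inRange r<k | inRange c<k
    ... | fin i | fin j = trans (extendMatrix-toℕ M i j) (ineligible≡0 i j
      (subst (_< k) (+-suc (toℕ i) (toℕ j)) (≰⇒> ineligible)))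

    column-sum : ∀ c → c < k → sumTo k (λ r → N r c) ≡ extend b c
    column-sum c c<k with inRange c<k
    ... | fin j = trans (sym (sumFin≡sumTo k (λ i → sym (extendMatrix-toℕ M i j))))
                        (trans (column≡ j) (sym (extend-toℕ b j)))

    row-sum : ∀ r → r < k → sumTo k (N r) ≡ row r
    row-sum r r<k with inRange r<k
    ... | fin i = trans (sym (sumFin≡sumTo k (λ j → sym (extendMatrix-toℕ M i j))))
                        (trans (row≡ i) (sym (row-opposite i)))

    exclusion : ∀ r r' c c' → r' < k → c' < k → Eligible r c → r < r' → c < c' →
                N r' c ≡ 0 ⊎ N r c' ≡ 0
    exclusion r r' c c' r'<k c'<k eligible r<r' c<c'
      with inRange (<-trans r<r' r'<k) | inRange r'<k | inRange (<-trans c<c' c'<k) | inRange c'<k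
    ... | fin i | fin i' | fin j | fin j'
      with exclusive i i' j j' (subst (k ≤_) (trans (+-suc (toℕ i) (toℕ j)) (+-comm 1 _)) eligible) r<r' c<c'
    ... | inj₁ below≡0 = inj₁ (trans (extendMatrix-toℕ M i' j) below≡0)
    ... | inj₂ right≡0 = inj₂ (trans (extendMatrix-toℕ M i j') right≡0)

  balanced : sumFin a ≡ sumFin b → sumTo k (extend b) ≡ sumTo k row
  balanced totals≡ = begin
    sumTo k (extend b)  ≡⟨ sumFin≡sumTo-extend b ⟨
    sumFin b            ≡⟨ totals≡ ⟨
    sumFin a            ≡⟨ sumFin≡sumTo-extend a ⟩
    sumTo k (extend a)  ≡⟨ sumTo-reverse k (extend a) ⟨
    sumTo k row         ∎
    where open ≡-Reasoning

  tailSum≡suffixSum : ∀ (f : Fin k → ℕ) {i} → i ≤ k → tailSum f i ≡ suffixSum k (extend f) i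
  tailSum≡suffixSum f {i} i≤k = trans
    (sumFin≡sumTo k (λ j → cong (λ z → if k ≤ᵇ toℕ j + i then z else 0) (sym (extend-toℕ f j))))
    (masked-sum≡suffixSum (extend f) i≤k)

  fits : sumFin a ≡ sumFin b → (∀ i → 1 ≤ i → i ≤ k → tailSum a i ≤ tailSum b i) →
         ∀ c → c < k → sumTo (suc c) (extend b) ≤ sumTo k (λ r → if k ≤ᵇ r + suc c then row r else 0)
  fits totals≡ tails≤ c c<k = begin
    sumTo (suc c) (extend b)                                ≡⟨ cong (λ l → sumTo l (extend b)) k∸[k∸1+c]≡1+c ⟨
    sumTo (k ∸ (k ∸ suc c)) (extend b)                      ≤⟨ prefix-≤ (extend b) (extend a) (m∸n≤m k (suc c))
                                                                (trans (balanced totals≡) (sumTo-reverse k (extend a)))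
                                                                (suffix≤ (k ∸ suc c) (m∸n≤m k (suc c))) ⟩
    sumTo (k ∸ (k ∸ suc c)) (extend a)                      ≡⟨ cong (λ l → sumTo l (extend a)) k∸[k∸1+c]≡1+c ⟩
    sumTo (suc c) (extend a)                                ≡⟨ suffixSum-reverse (extend a) c<k ⟨
    suffixSum k row (suc c)                                 ≡⟨ masked-sum≡suffixSum row c<k ⟨
    sumTo k (λ r → if k ≤ᵇ r + suc c then row r else 0)     ∎
    where
    open ≤-Reasoning
    k∸[k∸1+c]≡1+c = m∸[m∸n]≡n c<k
    suffix≤ : ∀ i → i ≤ k → suffixSum k (extend a) i ≤ suffixSum k (extend b) i
    suffix≤ zero    _   = z≤n
    suffix≤ (suc i) i<k = subst₂ _≤_ (tailSum≡suffixSum a i<k) (tailSum≡suffixSum b i<k) (tails≤ (suc i) (s≤s z≤n) i<k)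

lemma5p3 : (k : ℕ) (a b : Fin k → ℕ) →
    sumFin a ≡ sumFin b →
    (∀ (i : ℕ) → 1 ≤ i → i ≤ k → tailSum a i ≤ tailSum b i) →
    Σ[ M ∈ Matrix k ] (IsGoodMatrix k a b M ×
      (∀ (M' : Matrix k) → IsGoodMatrix k a b M' → ∀ r c → M' r c ≡ M r c))
lemma5p3 k a b totals≡ tails≤ =
    (λ i j → greedyMatrix (toℕ i) (toℕ j))
  , restrict-good good
  , λ M' good' r c → trans (sym (extendMatrix-toℕ M' r c))
                           (good-unique (extend-good good') good (toℕ c) (toℕ r) (toℕ<n c) (toℕ<n r))
  where
  open FinStaircase a b
  good : Good greedyMatrix
  good = greedy-good (fits totals≡ tails≤) (balanced totals≡)
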